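{- For a relation $\beta:Y\rightharpoonup\wp(Z)$ and a partial function $g:Z\rightharpoonup\wp(W)$, $\beta_*g_*=(\beta g_*)_*$.
   Context: Relations $\alpha:X\rightharpoonup Y$ are subsets of $X\times Y$ (sets with the axiom of choice); juxtaposition is relational composition; $\sqsubseteq$ inclusion, $\sqcup$ union; $\mathrm{dom}\,\alpha=\{(x,x)\mid\exists y.\,(x,y)\in\alpha\}$; a pfn (partial function) is a univalent relation. For $f:Y\rightharpoonup\wp(Z)$, $(B,A)\in f_\circ$ iff $A=\bigcup\{C\mid\exists b\in B.\,(b,C)\in f\}$. For $v\sqsubseteq\mathrm{id}_Y$, $\hat u_v=\{(A,A)\mid A\subseteq Y,\ \forall a\in A.\,(a,a)\in v\}$. $f\sqsubseteq_c\beta$ means $f\sqsubseteq\beta$, $f$ a pfn, $\mathrm{dom}\,f=\mathrm{dom}\,\beta$. Peleg lifting: $\beta_*=\bigsqcup_{f\sqsubseteq_c\beta}\hat u_{\mathrm{dom}\,\beta}f_\circ$. -}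

module Defs where

open import Level using (Level; _⊔_; suc; 0ℓ)
open import Data.Product using (Σ; ∃; ∃-syntax; _×_; _,_)
open import Relation.Binary.PropositionalEquality using (_≡_)
open import Relation.Unary using (Pred; _≐_)
open import Relation.Binary.Core using (REL)

private
  variable
    a b c ℓ ℓ₁ ℓ₂ : Level

-- Power set: subsets of a set X (X : Set) as predicates; equality of
-- subsets is extensional equality _≐_ (mutual inclusion).
℘ : Set → Set₁
℘ X = Pred X 0ℓ

_⊑_ : {A : Set a} {B : Set b} → REL A B ℓ₁ → REL A B ℓ₂ → Set _
α ⊑ β = ∀ {x y} → α x y → β x y

_≡ᴿ_ : {A : Set a} {B : Set b} → REL A B ℓ₁ → REL A B ℓ₂ → Set _
α ≡ᴿ β = (α ⊑ β) × (β ⊑ α)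

infix 4 _⊑_ _≡ᴿ_

_⨾_ : {A : Set a} {B : Set b} {C : Set c} →
      REL A B ℓ₁ → REL B C ℓ₂ → REL A C (b ⊔ ℓ₁ ⊔ ℓ₂)
(α ⨾ γ) x z = ∃[ y ] (α x y × γ y z)

infixl 7 _⨾_

dom : {X : Set} {B : Set b} → REL X B ℓ → REL X X (b ⊔ ℓ)
dom α x x′ = (x ≡ x′) × (∃[ y ] α x y)

IsPfn : {X Z : Set} → REL X (℘ Z) ℓ → Set _
IsPfn f = ∀ {x C C′} → f x C → f x C′ → C ≐ C′

-- A relation into a power set respects set equality (automatic for sets).
Respects℘ : {X Z : Set} → REL X (℘ Z) ℓ → Set _
Respects℘ β = ∀ {x C C′} → C ≐ C′ → β x C → β x C′

⋃[_]_ : {Y Z : Set} → REL Y (℘ Z) ℓ → ℘ Y → Pred Z (suc 0ℓ ⊔ ℓ)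
(⋃[ f ] B) z = ∃[ C ] ((∃[ b ] (B b × f b C)) × C z)

_∘° : {Y Z : Set} → REL Y (℘ Z) ℓ → REL (℘ Y) (℘ Z) (suc 0ℓ ⊔ ℓ)
(f ∘°) B A = A ≐ (⋃[ f ] B)

û : {Y : Set} → REL Y Y ℓ → REL (℘ Y) (℘ Y) ℓ
û v A A′ = (A ≐ A′) × (∀ a → A a → v a a)

_⊑c_ : {Y Z : Set} → REL Y (℘ Z) ℓ → REL Y (℘ Z) ℓ → Set _
f ⊑c β = (f ⊑ β) × IsPfn f × (dom f ≡ᴿ dom β)

-- Peleg lifting: β* = ⊔_{f ⊑c β} û_{dom β} f∘.
_* : {Y Z : Set} → REL Y (℘ Z) ℓ → REL (℘ Y) (℘ Z) (suc 0ℓ ⊔ suc ℓ)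
(_* {ℓ = ℓ} {Y = Y} {Z = Z} β) A B =
  Σ (REL Y (℘ Z) ℓ) λ f → (f ⊑c β) × (û (dom β) ⨾ (f ∘°)) A B

-- Since g is a partial function, (g *) C E says exactly that C ⊆ dom g and
-- E ≐ ⋃[ g ] C. Hence, on the source set A, a choice function h ⊑c β ⨾ g* is
-- the same thing as a choice function f ⊑c β followed by g∘, and both sides
-- of the equation are the union of g over the union of f over A. Each
-- direction builds the missing choice function by selecting at every point a
-- value compatible with the given one; excluded middle supplies the selected
-- witnesses and turns the large unions back into elements of ℘.

module Submission where

open import Defs
open import Level using (Level; _⊔_)
open import Relation.Binary.Core using (REL)
open import Relation.Binary.Definitions using (_Respects_)
open import Axiom.ExcludedMiddle using (ExcludedMiddle)
open import Data.Product using (Σ-syntax; ∃; ∃-syntax; _×_; _,_; proj₁; proj₂)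
open import Data.Empty.Polymorphic using (⊥)
open import Data.Empty using (⊥-elim)
open import Relation.Nullary using (Dec; yes; no)
open import Relation.Nullary.Decidable using (True; toWitness; fromWitness)
open import Relation.Binary.PropositionalEquality using (refl)
open import Relation.Unary using (Pred; _⊆_; _≐_)
open import Function using (_∘_)
open import Relation.Unary.Properties using (≐-refl; ≐-sym; ≐-trans)

private
  variable
    ℓ ℓ′ ℓ₁ ℓ₂ ℓ₃ : Level
    Y Z W : Set

Dom : {X : Set} {B : Set ℓ′} → REL X B ℓ → Pred X (ℓ′ ⊔ ℓ)
Dom β x = ∃ (β x)

Dom-⊑c : {f β : REL Y (℘ Z) ℓ} → f ⊑c β → Dom β ⊆ Dom f
Dom-⊑c (_ , _ , _ , domβ⊑domf) βy = proj₂ (domβ⊑domf (refl , βy))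

⋃-resp-≐ : (f : REL Y (℘ Z) ℓ) {B B′ : ℘ Y} → B ≐ B′ → ⋃[ f ] B ≐ ⋃[ f ] B′
⋃-resp-≐ f (B⊆B′ , B′⊆B) =
  (λ (C , (b , Bb , fbC) , Cz) → C , (b , B⊆B′ Bb , fbC) , Cz) ,
  (λ (C , (b , B′b , fbC) , Cz) → C , (b , B′⊆B B′b , fbC) , Cz)

⋃-⊑c : {k g : REL Z (℘ W) ℓ} → k ⊑c g → IsPfn g → (C : ℘ Z) → ⋃[ k ] C ≐ ⋃[ g ] C
⋃-⊑c {k = k} {g} k⊑cg@(k⊑g , _) g-pfn C = ⋃k⊆⋃g , ⋃g⊆⋃k
  where
    ⋃k⊆⋃g : ⋃[ k ] C ⊆ ⋃[ g ] C
    ⋃k⊆⋃g (X , (b , Cb , kbX) , Xw) = X , (b , Cb , k⊑g kbX) , Xw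
    ⋃g⊆⋃k : ⋃[ g ] C ⊆ ⋃[ k ] C
    ⋃g⊆⋃k (X , (b , Cb , gbX) , Xw) =
      let (X′ , kbX′) = Dom-⊑c k⊑cg (X , gbX)
      in X′ , (b , Cb , kbX′) , proj₂ (g-pfn (k⊑g kbX′) gbX) Xw

Composes : ℘ Y → REL Y (℘ Z) ℓ₁ → REL Z (℘ W) ℓ₂ → REL Y (℘ W) ℓ₃ → Set _
Composes A f g h =
  (∀ {a E} → A a → h a E → ∃[ C ] (f a C × E ≐ ⋃[ g ] C)) ×
  (∀ {a C} → A a → f a C → ∃[ E ] (h a E × E ≐ ⋃[ g ] C))

⋃-Composes : {A : ℘ Y} {B : ℘ Z} {f : REL Y (℘ Z) ℓ₁} {g : REL Z (℘ W) ℓ₂}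
  {h : REL Y (℘ W) ℓ₃} → Composes A f g h → B ≐ ⋃[ f ] A → ⋃[ h ] A ≐ ⋃[ g ] B
⋃-Composes (h⇒f , f⇒h) (B⊆⋃ , ⋃⊆B) =
  (λ (E , (a , Aa , haE) , Ew) →
    let (C , faC , E≐) = h⇒f Aa haE
        (X , (b , Cb , gbX) , Xw) = proj₁ E≐ Ew
    in X , (b , ⋃⊆B (C , (a , Aa , faC) , Cb) , gbX) , Xw) ,
  (λ (X , (b , Bb , gbX) , Xw) →
    let (C , (a , Aa , faC) , Cb) = B⊆⋃ Bb
        (E , haE , E≐) = f⇒h Aa faC
    in E , (a , Aa , haE) , proj₂ E≐ (X , (b , Cb , gbX) , Xw))

*-elim : {β : REL Y (℘ Z) ℓ} {A : ℘ Y} {B : ℘ Z} → (β *) A B →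
  Σ[ f ∈ REL Y (℘ Z) ℓ ] (f ⊑c β × A ⊆ Dom β × B ≐ ⋃[ f ] A)
*-elim (f , f⊑cβ , A′ , (A≐A′ , A⊆domβ) , B≐) =
  f , f⊑cβ , (λ {a} Aa → proj₂ (A⊆domβ a Aa)) , ≐-trans B≐ (⋃-resp-≐ f (≐-sym A≐A′))

*-intro : {β f : REL Y (℘ Z) ℓ} {A : ℘ Y} {B : ℘ Z} →
  f ⊑c β → A ⊆ Dom β → B ≐ ⋃[ f ] A → (β *) A B
*-intro {A = A} f⊑cβ A⊆Domβ B≐ = _ , f⊑cβ , A , (≐-refl , λ _ Aa → refl , A⊆Domβ Aa) , B≐

*-respˡ-≐ : {β : REL Y (℘ Z) ℓ} {A A′ : ℘ Y} {B : ℘ Z} → A ≐ A′ → (β *) A B → (β *) A′ B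
*-respˡ-≐ A≐A′ β*AB =
  let (f , f⊑cβ , A⊆Domβ , B≐) = *-elim β*AB
  in *-intro f⊑cβ (λ A′a → A⊆Domβ (proj₂ A≐A′ A′a)) (≐-trans B≐ (⋃-resp-≐ _ A≐A′))

*-respʳ-≐ : {β : REL Y (℘ Z) ℓ} {A : ℘ Y} {B B′ : ℘ Z} → B ≐ B′ → (β *) A B → (β *) A B′
*-respʳ-≐ B≐B′ (f , f⊑cβ , A′ , û-part , B≐) = f , f⊑cβ , A′ , û-part , ≐-trans (≐-sym B≐B′) B≐

*-pfn-elim : {g : REL Z (℘ W) ℓ} {C : ℘ Z} {E : ℘ W} → IsPfn g → (g *) C E →
  C ⊆ Dom g × E ≐ ⋃[ g ] C
*-pfn-elim g-pfn g*CE =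
  let (k , k⊑cg , C⊆Domg , E≐) = *-elim g*CE
  in C⊆Domg , ≐-trans E≐ (⋃-⊑c k⊑cg g-pfn _)

*-pfn-intro : {g : REL Z (℘ W) ℓ} {C : ℘ Z} {E : ℘ W} → IsPfn g →
  C ⊆ Dom g → E ≐ ⋃[ g ] C → (g *) C E
*-pfn-intro g-pfn = *-intro ((λ gbX → gbX) , g-pfn , (λ d → d) , (λ d → d))

module Select (S : Pred (℘ Z) ℓ) (P : Pred (℘ Z) ℓ′) where

  Preferred : Pred (℘ Z) _
  Preferred C = S C × (∃ P → P C)

  select : Dec (∃ Preferred) → Pred (℘ Z) ℓ
  select (yes (C₀ , _)) C = S C × C ≐ C₀
  select (no _)         _ = ⊥

  select-⊆ : ∀ d → select d ⊆ S
  select-⊆ (yes _) (SC , _) = SC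

  select-unique : ∀ d {C C′} → select d C → select d C′ → C ≐ C′
  select-unique (yes _) (_ , C≐C₀) (_ , C′≐C₀) = ≐-trans C≐C₀ (≐-sym C′≐C₀)

  -- If no C were preferred then P would be empty, making every C ∈ S preferred.
  select-nonempty : P ⊆ S → ∀ d → ∃ S → ∃ (select d)
  select-nonempty _   (yes (C₀ , SC₀ , _)) _ = C₀ , SC₀ , ≐-refl
  select-nonempty P⊆S (no ¬pref) (C , SC) =
    ⊥-elim (¬pref (C , SC , λ (C′ , PC′) → ⊥-elim (¬pref (C′ , P⊆S PC′ , λ _ → PC′))))

  select-preferred : P Respects _≐_ → ∀ d → ∃ P → select d ⊆ P
  select-preferred P-resp (yes (C₀ , _ , pref)) ∃P (_ , C≐C₀) = P-resp (≐-sym C≐C₀) (pref ∃P)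

module Classical (lem : ∀ {ℓ} → ExcludedMiddle ℓ) where

  resize : {X : Set} → Pred X ℓ → ℘ X
  resize P x = True (lem {P = P x})

  resize-≐ : {X : Set} (P : Pred X ℓ) → resize P ≐ P
  resize-≐ P = toWitness , fromWitness

  choose : (R : REL Y (℘ Z) ℓ) → REL Y (℘ Z) ℓ′ → REL Y (℘ Z) ℓ
  choose R Q y = select (R y) (Q y) lem
    where open Select

  module _ {R : REL Y (℘ Z) ℓ} {Q : REL Y (℘ Z) ℓ′} where

    choose-⊑c : Q ⊑ R → choose R Q ⊑c R
    choose-⊑c Q⊑R =
        (λ {y} → select-⊆ (R y) (Q y) lem)
      , (λ {y} → select-unique (R y) (Q y) lem)
      , (λ {y} (eq , C , chosen) → eq , C , select-⊆ (R y) (Q y) lem chosen)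
      , (λ {y} (eq , ∃Ry) → eq , select-nonempty (R y) (Q y) Q⊑R lem ∃Ry)
      where open Select

    choose-⊆ : Respects℘ Q → ∀ {y} → ∃ (Q y) → choose R Q y ⊆ Q y
    choose-⊆ Q-resp {y} = select-preferred Q-resp lem
      where open Select (R y) (Q y)

  module _ {β : REL Y (℘ Z) ℓ₁} {g : REL Z (℘ W) ℓ₂} (g-pfn : IsPfn g) where

    *⨾*⊑ : (β *) ⨾ (g *) ⊑ (β ⨾ (g *)) *
    *⨾*⊑ {A} {D} (B , β*AB , g*BD)
      with (f , f⊑cβ@(f⊑β , f-pfn , _) , A⊆Domβ , B≐⋃fA) ← *-elim β*AB
         | (B⊆Domg , D≐⋃gB) ← *-pfn-elim g-pfn g*BD
      = *-intro h⊑c A⊆Dom (≐-trans D≐⋃gB (≐-sym (⋃-Composes composes B≐⋃fA)))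
      where
        Q : REL Y (℘ W) _
        Q y E = ∃[ C ] (f y C × (g *) C E)

        Q⊑ : Q ⊑ β ⨾ (g *)
        Q⊑ (C , fyC , g*CE) = C , f⊑β fyC , g*CE

        Q-resp : Respects℘ Q
        Q-resp E≐E′ (C , fyC , g*CE) = C , fyC , *-respʳ-≐ E≐E′ g*CE

        h : REL Y (℘ W) _
        h = choose (β ⨾ (g *)) Q

        h⊑c : h ⊑c (β ⨾ (g *))
        h⊑c = choose-⊑c Q⊑

        h⊆Q : ∀ {y} → ∃ (Q y) → h y ⊆ Q y
        h⊆Q = choose-⊆ {R = β ⨾ (g *)} {Q = Q} Q-resp

        image⊆B : ∀ {a C} → A a → f a C → C ⊆ B
        image⊆B Aa faC Cb = proj₂ B≐⋃fA (_ , (_ , Aa , faC) , Cb)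

        A⊆DomQ : A ⊆ Dom Q
        A⊆DomQ Aa =
          let (C , faC) = Dom-⊑c f⊑cβ (A⊆Domβ Aa)
          in resize (⋃[ g ] C) , C , faC ,
             *-pfn-intro g-pfn (B⊆Domg ∘ image⊆B Aa faC) (resize-≐ (⋃[ g ] C))

        A⊆Dom : A ⊆ Dom (β ⨾ (g *))
        A⊆Dom Aa = let (E , QaE) = A⊆DomQ Aa in E , Q⊑ QaE

        composes : Composes A f g h
        composes =
          (λ Aa haE →
            let (C , faC , g*CE) = h⊆Q (A⊆DomQ Aa) haE
            in C , faC , proj₂ (*-pfn-elim g-pfn g*CE)) ,
          (λ Aa faC →
            let (E , haE) = Dom-⊑c h⊑c (A⊆Dom Aa)
                (C′ , faC′ , g*C′E) = h⊆Q (A⊆DomQ Aa) haE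
            in E , haE , ≐-trans (proj₂ (*-pfn-elim g-pfn g*C′E)) (⋃-resp-≐ g (f-pfn faC′ faC)))

    *⨾*⊒ : Respects℘ β → (β ⨾ (g *)) * ⊑ (β *) ⨾ (g *)
    *⨾*⊒ β-resp {A} {D} [β⨾g*]*AD
      with (h , h⊑c@(h⊑ , h-pfn , _) , A⊆Dom , D≐⋃hA) ← *-elim [β⨾g*]*AD
      = B , *-intro f⊑c A⊆Domβ (resize-≐ (⋃[ f ] A))
          , *-pfn-intro g-pfn B⊆Domg (≐-trans D≐⋃hA (⋃-Composes composes (resize-≐ (⋃[ f ] A))))
      where
        Q : REL Y (℘ Z) _
        Q y C = ∃[ E ] (h y E × β y C × (g *) C E)

        Q⊑β : Q ⊑ β
        Q⊑β (_ , _ , βyC , _) = βyC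

        Q-resp : Respects℘ Q
        Q-resp C≐C′ (E , hyE , βyC , g*CE) = E , hyE , β-resp C≐C′ βyC , *-respˡ-≐ C≐C′ g*CE

        f : REL Y (℘ Z) _
        f = choose β Q

        f⊑c : f ⊑c β
        f⊑c = choose-⊑c Q⊑β

        f⊆Q : ∀ {y} → ∃ (Q y) → f y ⊆ Q y
        f⊆Q = choose-⊆ {R = β} {Q = Q} Q-resp

        B : ℘ Z
        B = resize (⋃[ f ] A)

        A⊆DomQ : A ⊆ Dom Q
        A⊆DomQ Aa =
          let (E , haE) = Dom-⊑c h⊑c (A⊆Dom Aa)
              (C , βaC , g*CE) = h⊑ haE
          in C , E , haE , βaC , g*CE

        A⊆Domβ : A ⊆ Dom β
        A⊆Domβ Aa = let (C , QaC) = A⊆DomQ Aa in C , Q⊑β QaC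

        B⊆Domg : B ⊆ Dom g
        B⊆Domg Bb =
          let (C , (a , Aa , faC) , Cb) = proj₁ (resize-≐ (⋃[ f ] A)) Bb
              (_ , _ , _ , g*CE) = f⊆Q (A⊆DomQ Aa) faC
          in proj₁ (*-pfn-elim g-pfn g*CE) Cb

        composes : Composes A f g h
        composes =
          (λ Aa haE →
            let (C , faC) = Dom-⊑c f⊑c (A⊆Domβ Aa)
                (E′ , haE′ , _ , g*CE′) = f⊆Q (A⊆DomQ Aa) faC
            in C , faC , ≐-trans (h-pfn haE haE′) (proj₂ (*-pfn-elim g-pfn g*CE′))) ,
          (λ Aa faC →
            let (E , haE , _ , g*CE) = f⊆Q (A⊆DomQ Aa) faC
            in E , haE , proj₂ (*-pfn-elim g-pfn g*CE))

proposition7p7 : (lem : ∀ {ℓ} → ExcludedMiddle ℓ) →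
    ∀ {ℓβ ℓg : Level} {Y Z W : Set} →
    (β : REL Y (℘ Z) ℓβ) (g : REL Z (℘ W) ℓg) →
    Respects℘ β → Respects℘ g → IsPfn g →
    (β *) ⨾ (g *) ≡ᴿ (β ⨾ (g *)) *
proposition7p7 lem β g β-resp _ g-pfn = *⨾*⊑ g-pfn , *⨾*⊒ g-pfn β-resp
  where open Classical lem
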